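{- Let $\pi\in S_n$ and $e=\Theta(\pi)$. Then: (a) $\pi$ avoids the vincular pattern $2\underline{134}$ if and only if $e$ avoids the consecutive pattern of relations $(\underline{>,\geq})$. Consequently $|S_n(\underline{124}3)|=|S_n(2\underline{134})|=|\mathbf{I}_n(\underline{>,\geq})|$. (b) $\pi$ avoids the vincular pattern $3\underline{124}$ if and only if $e$ avoids $(\underline{\geq,>})$. Consequently $|S_n(\underline{421}3)|=|S_n(3\underline{124})|=|\mathbf{I}_n(\underline{\geq,>})|$.
   Context: An inversion sequence of length $n$ is an integer sequence $e=e_1\dots e_n$ with $0\le e_i<i$; $\mathbf{I}_n$ is the set of these. The map $\Theta:S_n\to\mathbf{I}_n$ sends $\pi$ to $e$ with $e_i=|\{j<i:\pi_j>\pi_i\}|$. For relations $R_1,R_2$, $e$ contains $(\underline{R_1,R_2})$ if some $i$ has $e_iR_1e_{i+1}$ and $e_{i+1}R_2e_{i+2}$; $\mathbf{I}_n(\underline{R_1,R_2})$ is the set of avoiders. Vincular patterns: $\pi$ contains $2\underline{134}$ if there are $j<i$ with $\pi_i<\pi_j<\pi_{i+1}<\pi_{i+2}$; contains $3\underline{124}$ if there are $j<i$ with $\pi_i<\pi_{i+1}<\pi_j<\pi_{i+2}$; contains $\underline{124}3$ if there are $i$ and $k>i+2$ with $\pi_i<\pi_{i+1}<\pi_k<\pi_{i+2}$; contains $\underline{421}3$ if there are $i$ and $k>i+2$ with $\pi_{i+2}<\pi_{i+1}<\pi_k<\pi_i$. $S_n(\sigma)$ is the set of permutations in $S_n$ avoiding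 $\sigma$. -}

module Defs where

open import Data.Nat using (ℕ; suc; _≤_; _<_; _>_; _≥_)
open import Data.Fin using (Fin; toℕ)
import Data.Fin as F
open import Data.Fin.Permutation using (Permutation′; _⟨$⟩ʳ_)
open import Data.List using (List; length; filter; allFin)
open import Data.Product using (Σ; ∃; _×_; proj₁)
open import Relation.Nullary using (¬_)
open import Relation.Nullary.Decidable using (_×-dec_)
open import Relation.Binary using (Setoid; Rel)
open import Relation.Binary.PropositionalEquality using (_≡_; _→-setoid_)
import Relation.Binary.Construct.On as On

-- Conventions: positions are 0-based (Fin n); π_i is written π ⟨$⟩ʳ i.

Consec3 : ∀ {n} → Fin n → Fin n → Fin n → Set
Consec3 i i₁ i₂ = toℕ i₁ ≡ suc (toℕ i) × toℕ i₂ ≡ suc (toℕ i₁)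

Θ : ∀ {n} → Permutation′ n → Fin n → ℕ
Θ {n} π i = length (filter (λ j → (j F.<? i) ×-dec ((π ⟨$⟩ʳ i) F.<? (π ⟨$⟩ʳ j))) (allFin n))

-- Inversion sequences (0-based: e_i ≤ i, i.e. e_{i+1} < i+1 in 1-based indexing).
IsInvSeq : ∀ {n} → (Fin n → ℕ) → Set
IsInvSeq e = ∀ i → e i ≤ toℕ i

ContainsRel : ∀ {n} → Rel ℕ _ → Rel ℕ _ → (Fin n → ℕ) → Set
ContainsRel {n} R₁ R₂ e =
  Σ (Fin n) λ i → Σ (Fin n) λ i₁ → Σ (Fin n) λ i₂ →
    Consec3 i i₁ i₂ × R₁ (e i) (e i₁) × R₂ (e i₁) (e i₂)

Contains2-134 : ∀ {n} → Permutation′ n → Set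
Contains2-134 {n} π = Σ (Fin n) λ j → Σ (Fin n) λ i → Σ (Fin n) λ i₁ → Σ (Fin n) λ i₂ →
  Consec3 i i₁ i₂ × j F.< i ×
  (π ⟨$⟩ʳ i) F.< (π ⟨$⟩ʳ j) × (π ⟨$⟩ʳ j) F.< (π ⟨$⟩ʳ i₁) × (π ⟨$⟩ʳ i₁) F.< (π ⟨$⟩ʳ i₂)

Contains3-124 : ∀ {n} → Permutation′ n → Set
Contains3-124 {n} π = Σ (Fin n) λ j → Σ (Fin n) λ i → Σ (Fin n) λ i₁ → Σ (Fin n) λ i₂ →
  Consec3 i i₁ i₂ × j F.< i ×
  (π ⟨$⟩ʳ i) F.< (π ⟨$⟩ʳ i₁) × (π ⟨$⟩ʳ i₁) F.< (π ⟨$⟩ʳ j) × (π ⟨$⟩ʳ j) F.< (π ⟨$⟩ʳ i₂)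

Contains124-3 : ∀ {n} → Permutation′ n → Set
Contains124-3 {n} π = Σ (Fin n) λ i → Σ (Fin n) λ i₁ → Σ (Fin n) λ i₂ → Σ (Fin n) λ k →
  Consec3 i i₁ i₂ × i₂ F.< k ×
  (π ⟨$⟩ʳ i) F.< (π ⟨$⟩ʳ i₁) × (π ⟨$⟩ʳ i₁) F.< (π ⟨$⟩ʳ k) × (π ⟨$⟩ʳ k) F.< (π ⟨$⟩ʳ i₂)

Contains421-3 : ∀ {n} → Permutation′ n → Set
Contains421-3 {n} π = Σ (Fin n) λ i → Σ (Fin n) λ i₁ → Σ (Fin n) λ i₂ → Σ (Fin n) λ k →
  Consec3 i i₁ i₂ × i₂ F.< k ×
  (π ⟨$⟩ʳ i₂) F.< (π ⟨$⟩ʳ i₁) × (π ⟨$⟩ʳ i₁) F.< (π ⟨$⟩ʳ k) × (π ⟨$⟩ʳ k) F.< (π ⟨$⟩ʳ i)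

-- S_n(σ) as a setoid: permutations satisfying P (e.g. avoiding σ), compared pointwise.
PermsAvoiding : (n : ℕ) → (Permutation′ n → Set) → Setoid _ _
PermsAvoiding n P =
  On.setoid {B = Σ (Permutation′ n) P} (Fin n →-setoid Fin n) (λ x i → proj₁ x ⟨$⟩ʳ i)

-- I_n(R₁,R₂) as a setoid: inversion sequences avoiding (R₁,R₂), compared pointwise.
InvSeqAvoiding : (n : ℕ) → Rel ℕ _ → Rel ℕ _ → Setoid _ _
InvSeqAvoiding n R₁ R₂ =
  On.setoid {B = Σ (Fin n → ℕ) (λ e → IsInvSeq e × ¬ ContainsRel R₁ R₂ e)}
    (Fin n →-setoid ℕ) proj₁

module Submission where

-- Write invCount f i = #{ j < i : f i < f j }, so that Θ π = invCount π.
-- The heart of the proof is a lemma about two adjacent positions a, a+1 of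
-- an injective f: a descent f a > f (a+1) happens exactly when the count
-- increases; on an ascent the count does not increase, and it decreases
-- exactly when some j < a has f a < f j < f (a+1).  Reading occurrences of
-- 2-134 and 3-124 through this lemma gives the equivalences of (a) and (b).
--
-- The enumerative statements are explicit bijections.  Θ is inverted by
-- `decode`, which puts the value n ∸ e_(n-1) last and decodes the prefix
-- (inserting a value at the end leaves all earlier counts unchanged).
-- Reverse-complement exchanges 124-3 with 2-134, and reversal exchanges
-- 421-3 with 3-124; as involutions they restrict to bijections of avoiders.

open import Defs
open import Data.Nat using (ℕ; _>_; _≥_)
open import Data.Fin.Permutation using (Permutation′)
open import Data.Product using (_×_)
open import Relation.Nullary using (¬_)
open import Function.Bundles using (_⇔_; Inverse)

open import Level using (0ℓ)
open import Data.Nat as ℕ using (zero; suc; _+_; _∸_; z≤n; s≤s)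
import Data.Nat.Properties as ℕP
open import Data.Fin as F using (Fin; toℕ; fromℕ; fromℕ<; inject₁; punchIn; opposite)
import Data.Fin.Properties as FP
open import Data.Fin.Permutation as P using (_⟨$⟩ʳ_; _∘ₚ_; insert; remove; reverse)
open import Data.List using (length; filter; tabulate)
open import Data.Product using (∃; _,_; proj₁; map)
open import Data.Empty using (⊥-elim)
open import Relation.Nullary using (Dec; yes; no)
open import Relation.Nullary.Decidable using (_×-dec_)
open import Relation.Binary using (Rel)
open import Relation.Binary.Definitions using (tri<; tri≈; tri>)
open import Relation.Binary.PropositionalEquality
open import Function using (_∘_; id)
open import Function.Bundles using (mk⇔; Equivalence; Injection)
open import Function.Definitions using (Injective)
open import Function.Properties.Inverse using (Inverse⇒Injection)
open import Algebra.Properties.CommutativeMonoid.Sum ℕP.+-0-commutativeMonoid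
  using (sum; sum-syntax; sum-cong-≗; sum-init-last; ∑-permute)

𝟙 : ∀ {a} {A : Set a} → Dec A → ℕ
𝟙 (yes _) = 1
𝟙 (no _)  = 0

module _ {a b} {A : Set a} {B : Set b} where
  𝟙-cong : (A → B) → (B → A) → (d : Dec A) (d′ : Dec B) → 𝟙 d ≡ 𝟙 d′
  𝟙-cong A⇒B B⇒A (yes p) (yes q) = refl
  𝟙-cong A⇒B B⇒A (yes p) (no ¬q) = ⊥-elim (¬q (A⇒B p))
  𝟙-cong A⇒B B⇒A (no ¬p) (yes q) = ⊥-elim (¬p (B⇒A q))
  𝟙-cong A⇒B B⇒A (no ¬p) (no ¬q) = refl

  𝟙-mono : (A → B) → (d : Dec A) (d′ : Dec B) → 𝟙 d ℕ.≤ 𝟙 d′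
  𝟙-mono A⇒B (yes p) (yes q) = s≤s z≤n
  𝟙-mono A⇒B (yes p) (no ¬q) = ⊥-elim (¬q (A⇒B p))
  𝟙-mono A⇒B (no ¬p) d′      = z≤n

  𝟙-< : B → ¬ A → (d : Dec A) (d′ : Dec B) → 𝟙 d ℕ.< 𝟙 d′
  𝟙-< q ¬p (yes p) d′      = ⊥-elim (¬p p)
  𝟙-< q ¬p (no _)  (yes _) = s≤s z≤n
  𝟙-< q ¬p (no _)  (no ¬q) = ⊥-elim (¬q q)

  𝟙-<⁻ : (d : Dec A) (d′ : Dec B) → 𝟙 d ℕ.< 𝟙 d′ → B × ¬ A
  𝟙-<⁻ (yes p) (yes q) (s≤s ())
  𝟙-<⁻ (no ¬p) (yes q) _ = q , ¬p
  𝟙-<⁻ _       (no ¬q) ()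

𝟙-no : ∀ {a} {A : Set a} → ¬ A → (d : Dec A) → 𝟙 d ≡ 0
𝟙-no ¬p (yes p) = ⊥-elim (¬p p)
𝟙-no ¬p (no _)  = refl

length-filter-tabulate : ∀ {a p} {A : Set a} {Q : A → Set p} (Q? : ∀ x → Dec (Q x)) {n}
  (f : Fin n → A) → length (filter Q? (tabulate f)) ≡ ∑[ i < n ] 𝟙 (Q? (f i))
length-filter-tabulate Q? {zero}  f = refl
length-filter-tabulate Q? {suc n} f with Q? (f F.zero)
... | yes _ = cong suc (length-filter-tabulate Q? (f ∘ F.suc))
... | no _  = length-filter-tabulate Q? (f ∘ F.suc)

sum-mono : ∀ {n} (f g : Fin n → ℕ) → (∀ i → f i ℕ.≤ g i) → sum f ℕ.≤ sum g
sum-mono {zero}  f g f≤g = z≤n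
sum-mono {suc n} f g f≤g =
  ℕP.+-mono-≤ (f≤g F.zero) (sum-mono (f ∘ F.suc) (g ∘ F.suc) (f≤g ∘ F.suc))

sum-mono-< : ∀ {n} (f g : Fin n → ℕ) → (∀ i → f i ℕ.≤ g i) → ∀ k → f k ℕ.< g k → sum f ℕ.< sum g
sum-mono-< {suc n} f g f≤g F.zero fk<gk =
  ℕP.+-mono-<-≤ fk<gk (sum-mono (f ∘ F.suc) (g ∘ F.suc) (f≤g ∘ F.suc))
sum-mono-< {suc n} f g f≤g (F.suc k) fk<gk =
  ℕP.+-mono-≤-< (f≤g F.zero) (sum-mono-< (f ∘ F.suc) (g ∘ F.suc) (f≤g ∘ F.suc) k fk<gk)

sum-<⇒term-< : ∀ {n} (f g : Fin n → ℕ) → (∀ i → f i ℕ.≤ g i) → sum f ℕ.< sum g →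
  ∃ λ k → f k ℕ.< g k
sum-<⇒term-< {zero}  f g f≤g ()
sum-<⇒term-< {suc n} f g f≤g Σf<Σg with f F.zero ℕ.<? g F.zero
... | yes f₀<g₀ = F.zero , f₀<g₀
... | no f₀≮g₀  = map F.suc id (sum-<⇒term-< (f ∘ F.suc) (g ∘ F.suc) (f≤g ∘ F.suc) tail-<)
  where
  head-≡ : f F.zero ≡ g F.zero
  head-≡ = ℕP.≤-antisym (f≤g F.zero) (ℕP.≮⇒≥ f₀≮g₀)
  tail-< : sum (f ∘ F.suc) ℕ.< sum (g ∘ F.suc)
  tail-< = ℕP.+-cancelˡ-< (g F.zero) _ _ (subst (λ x → x + _ ℕ.< _) head-≡ Σf<Σg)

counted : ∀ {n} → (Fin n → Fin n) → Fin n → Fin n → ℕ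
counted f i j = 𝟙 ((j F.<? i) ×-dec (f i F.<? f j))

invCount : ∀ {n} → (Fin n → Fin n) → Fin n → ℕ
invCount {n} f i = ∑[ j < n ] counted f i j

Θ≡invCount : ∀ {n} (π : Permutation′ n) i → Θ π i ≡ invCount (π ⟨$⟩ʳ_) i
Θ≡invCount π i = length-filter-tabulate (λ j → (j F.<? i) ×-dec ((π ⟨$⟩ʳ i) F.<? (π ⟨$⟩ʳ j))) id

invCount-cong : ∀ {n} {f g : Fin n → Fin n} → (∀ k → f k ≡ g k) → ∀ i → invCount f i ≡ invCount g i
invCount-cong {n} f≗g i = sum-cong-≗ {n} λ j → 𝟙-cong
  (λ (j<i , fi<fj) → j<i , subst₂ F._<_ (f≗g i) (f≗g j) fi<fj)
  (λ (j<i , gi<gj) → j<i , subst₂ F._<_ (sym (f≗g i)) (sym (f≗g j)) gi<gj) _ _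

Θ-cong : ∀ {n} {π σ : Permutation′ n} → π P.≈ σ → ∀ i → Θ π i ≡ Θ σ i
Θ-cong {π = π} {σ} π≈σ i = trans (Θ≡invCount π i) (trans (invCount-cong π≈σ i) (sym (Θ≡invCount σ i)))

ContainsRel-cong : ∀ {n} {R₁ R₂ : Rel ℕ 0ℓ} {e e′ : Fin n → ℕ} → (∀ i → e i ≡ e′ i) →
  ContainsRel R₁ R₂ e → ContainsRel R₁ R₂ e′
ContainsRel-cong {R₁ = R₁} {R₂} e≗e′ (i , i₁ , i₂ , c , r₁ , r₂) =
  i , i₁ , i₂ , c , subst₂ R₁ (e≗e′ i) (e≗e′ i₁) r₁ , subst₂ R₂ (e≗e′ i₁) (e≗e′ i₂) r₂

_⋖_ : ∀ {n} → Fin n → Fin n → Set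
a ⋖ b = toℕ b ≡ suc (toℕ a)

⋖⇒< : ∀ {n} {a b : Fin n} → a ⋖ b → a F.< b
⋖⇒< {a = a} a⋖b = subst (toℕ a ℕ.<_) (sym a⋖b) ℕP.≤-refl

<-⋖⇒< : ∀ {n} {a b j : Fin n} → a ⋖ b → j F.< b → j ≢ a → j F.< a
<-⋖⇒< {j = j} a⋖b j<b j≢a =
  ℕP.≤∧≢⇒< (ℕP.≤-pred (subst (toℕ j ℕ.<_) a⋖b j<b)) (j≢a ∘ FP.toℕ-injective)

module AdjacentPositions {n} (f : Fin n → Fin n) (f-inj : Injective _≡_ _≡_ f) where

  ascent-counted : ∀ {a b} → a ⋖ b → f a F.< f b → ∀ j → counted f b j ℕ.≤ counted f a j
  ascent-counted {a} {b} a⋖b fa<fb j = 𝟙-mono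
    (λ (j<b , fb<fj) → <-⋖⇒< a⋖b j<b (λ { refl → FP.<-asym fa<fb fb<fj }) , FP.<-trans fa<fb fb<fj)
    _ _

  ascent⇒≥ : ∀ {a b} → a ⋖ b → f a F.< f b → invCount f b ℕ.≤ invCount f a
  ascent⇒≥ a⋖b fa<fb = sum-mono _ _ (ascent-counted a⋖b fa<fb)

  -- On a descent the count strictly increases: a itself is counted at a+1.
  descent⇒< : ∀ {a b} → a ⋖ b → f b F.< f a → invCount f a ℕ.< invCount f b
  descent⇒< {a} a⋖b fb<fa = sum-mono-< _ _
    (λ j → 𝟙-mono (λ (j<a , fa<fj) → FP.<-trans j<a (⋖⇒< a⋖b) , FP.<-trans fb<fa fa<fj) _ _)
    a (𝟙-< (⋖⇒< a⋖b , fb<fa) (λ (a<a , _) → FP.<-irrefl refl a<a) _ _)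

  ≥⇒ascent : ∀ {a b} → a ⋖ b → invCount f b ℕ.≤ invCount f a → f a F.< f b
  ≥⇒ascent {a} {b} a⋖b eb≤ea with FP.<-cmp (f a) (f b)
  ... | tri< fa<fb _ _ = fa<fb
  ... | tri≈ _ fa≡fb _ = ⊥-elim (FP.<-irrefl (f-inj fa≡fb) (⋖⇒< a⋖b))
  ... | tri> _ _ fb<fa = ⊥-elim (ℕP.<⇒≱ (descent⇒< a⋖b fb<fa) eb≤ea)

  between⇒drop : ∀ {a b j} → a ⋖ b → j F.< a → f a F.< f j → f j F.< f b →
    invCount f b ℕ.< invCount f a
  between⇒drop a⋖b j<a fa<fj fj<fb =
    sum-mono-< _ _ (ascent-counted a⋖b (FP.<-trans fa<fj fj<fb)) _
      (𝟙-< (j<a , fa<fj) (λ (_ , fb<fj) → FP.<-asym fj<fb fb<fj) _ _)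

  drop⇒between : ∀ {a b} → a ⋖ b → f a F.< f b → invCount f b ℕ.< invCount f a →
    ∃ λ j → j F.< a × f a F.< f j × f j F.< f b
  drop⇒between {a} {b} a⋖b fa<fb drop
    with sum-<⇒term-< _ _ (ascent-counted a⋖b fa<fb) drop
  ... | j , counted-at-a-only with 𝟙-<⁻ _ _ counted-at-a-only
  ... | (j<a , fa<fj) , not-at-b = j , j<a , fa<fj , fj<fb
    where
    j<b : j F.< b
    j<b = FP.<-trans j<a (⋖⇒< a⋖b)
    fj<fb : f j F.< f b
    fj<fb with FP.<-cmp (f j) (f b)
    ... | tri< lt _ _ = lt
    ... | tri≈ _ eq _ = ⊥-elim (FP.<-irrefl (f-inj eq) j<b)
    ... | tri> _ _ gt = ⊥-elim (not-at-b (j<b , gt))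

permutation-injective : ∀ {n} (π : Permutation′ n) → Injective _≡_ _≡_ (π ⟨$⟩ʳ_)
permutation-injective π = Injection.injective (Inverse⇒Injection π)

avoidance-via-Θ : ∀ {n} (π : Permutation′ n) {R₁ R₂ : Rel ℕ 0ℓ} {C : Set} →
  (C → ContainsRel R₁ R₂ (invCount (π ⟨$⟩ʳ_))) → (ContainsRel R₁ R₂ (invCount (π ⟨$⟩ʳ_)) → C) →
  (¬ C) ⇔ (¬ ContainsRel R₁ R₂ (Θ π))
avoidance-via-Θ π {R₁} {R₂} C⇒rel rel⇒C = mk⇔
  (λ ¬c rel → ¬c (rel⇒C (ContainsRel-cong {R₁ = R₁} {R₂} (Θ≡invCount π) rel)))
  (λ ¬rel c → ¬rel (ContainsRel-cong {R₁ = R₁} {R₂} (sym ∘ Θ≡invCount π) (C⇒rel c)))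

module Patterns {n} (π : Permutation′ n) where
  open AdjacentPositions (π ⟨$⟩ʳ_) (permutation-injective π)

  -- 2-134 at (j; i, i+1, i+2): the value π_j sits between π_i and π_(i+1).
  2-134⇒rel : Contains2-134 π → ContainsRel _>_ _≥_ (invCount (π ⟨$⟩ʳ_))
  2-134⇒rel (j , i , i₁ , i₂ , (c₁ , c₂) , j<i , p₁ , p₂ , p₃) =
    i , i₁ , i₂ , (c₁ , c₂) , between⇒drop c₁ j<i p₁ p₂ , ascent⇒≥ c₂ p₃

  rel⇒2-134 : ContainsRel _>_ _≥_ (invCount (π ⟨$⟩ʳ_)) → Contains2-134 π
  rel⇒2-134 (i , i₁ , i₂ , (c₁ , c₂) , drop , ge)
    with drop⇒between c₁ (≥⇒ascent c₁ (ℕP.<⇒≤ drop)) drop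
  ... | j , j<i , p₁ , p₂ = j , i , i₁ , i₂ , (c₁ , c₂) , j<i , p₁ , p₂ , ≥⇒ascent c₂ ge

  -- 3-124 at (j; i, i+1, i+2): the value π_j sits between π_(i+1) and π_(i+2).
  3-124⇒rel : Contains3-124 π → ContainsRel _≥_ _>_ (invCount (π ⟨$⟩ʳ_))
  3-124⇒rel (j , i , i₁ , i₂ , (c₁ , c₂) , j<i , p₁ , p₂ , p₃) =
    i , i₁ , i₂ , (c₁ , c₂) , ascent⇒≥ c₁ p₁ , between⇒drop c₂ (FP.<-trans j<i (⋖⇒< c₁)) p₂ p₃

  rel⇒3-124 : ContainsRel _≥_ _>_ (invCount (π ⟨$⟩ʳ_)) → Contains3-124 π
  rel⇒3-124 (i , i₁ , i₂ , (c₁ , c₂) , ge , drop)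
    with ≥⇒ascent c₁ ge | drop⇒between c₂ (≥⇒ascent c₂ (ℕP.<⇒≤ drop)) drop
  ... | p₁ | j , j<i₁ , p₂ , p₃ = j , i , i₁ , i₂ , (c₁ , c₂) , j<i , p₁ , p₂ , p₃
    where
    j<i : j F.< i
    j<i = <-⋖⇒< c₁ j<i₁ (λ { refl → FP.<-asym p₁ p₂ })

avoid2-134⇔ : ∀ {n} (π : Permutation′ n) → (¬ Contains2-134 π) ⇔ (¬ ContainsRel _>_ _≥_ (Θ π))
avoid2-134⇔ π = avoidance-via-Θ π {_>_} {_≥_} 2-134⇒rel rel⇒2-134
  where open Patterns π

avoid3-124⇔ : ∀ {n} (π : Permutation′ n) → (¬ Contains3-124 π) ⇔ (¬ ContainsRel _≥_ _>_ (Θ π))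
avoid3-124⇔ π = avoidance-via-Θ π {_≥_} {_>_} 3-124⇒rel rel⇒3-124
  where open Patterns π

data LastView {n} : Fin (suc n) → Set where
  last    : LastView (fromℕ n)
  earlier : (x : Fin n) → LastView (inject₁ x)

lastView : ∀ {n} (k : Fin (suc n)) → LastView k
lastView {zero}  F.zero    = last
lastView {suc n} F.zero    = earlier F.zero
lastView {suc n} (F.suc k) with lastView k
... | last      = last
... | earlier x = earlier (F.suc x)

fromℕ-maximal : ∀ {n} {k : Fin (suc n)} → ¬ (fromℕ n F.< k)
fromℕ-maximal {n} {k} n<k =
  ℕP.<⇒≱ n<k (subst (toℕ k ℕ.≤_) (sym (FP.toℕ-fromℕ n)) (FP.toℕ≤pred[n] k))

punchIn-fromℕ : ∀ {n} (x : Fin n) → punchIn (fromℕ n) x ≡ inject₁ x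
punchIn-fromℕ {suc n} F.zero    = refl
punchIn-fromℕ {suc n} (F.suc x) = cong F.suc (punchIn-fromℕ x)

insert-at : ∀ {n} i j (σ : Permutation′ n) → insert i j σ ⟨$⟩ʳ i ≡ j
insert-at i j σ with i FP.≟ i
... | yes _  = refl
... | no i≢i = ⊥-elim (i≢i refl)

insert-last-earlier : ∀ {n} v (σ : Permutation′ n) x →
  insert (fromℕ n) v σ ⟨$⟩ʳ inject₁ x ≡ punchIn v (σ ⟨$⟩ʳ x)
insert-last-earlier {n} v σ x =
  subst (λ k → insert (fromℕ n) v σ ⟨$⟩ʳ k ≡ punchIn v (σ ⟨$⟩ʳ x))
    (punchIn-fromℕ x) (P.insert-punchIn (fromℕ n) v σ x)

punchIn-mono-< : ∀ {n} (v : Fin (suc n)) {x y : Fin n} → x F.< y → punchIn v x F.< punchIn v y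
punchIn-mono-< v {x} {y} x<y =
  ℕP.≰⇒> (λ py≤px → ℕP.<⇒≱ x<y (FP.punchIn-cancel-≤ v y x py≤px))

punchIn-cancel-< : ∀ {n} (v : Fin (suc n)) {x y : Fin n} → punchIn v x F.< punchIn v y → x F.< y
punchIn-cancel-< v {x} {y} px<py =
  ℕP.≰⇒> (λ y≤x → ℕP.<⇒≱ px<py (FP.punchIn-mono-≤ v y x y≤x))

punchIn-above⇒ : ∀ {n} (v : Fin (suc n)) (x : Fin n) → v F.< punchIn v x → toℕ v ℕ.≤ toℕ x
punchIn-above⇒ F.zero    x         _         = z≤n
punchIn-above⇒ (F.suc v) F.zero    ()
punchIn-above⇒ (F.suc v) (F.suc x) (s≤s v<x) = s≤s (punchIn-above⇒ v x v<x)

punchIn-above⇐ : ∀ {n} (v : Fin (suc n)) (x : Fin n) → toℕ v ℕ.≤ toℕ x → v F.< punchIn v x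
punchIn-above⇐ F.zero    x         _         = s≤s z≤n
punchIn-above⇐ (F.suc v) F.zero    ()
punchIn-above⇐ (F.suc v) (F.suc x) (s≤s v≤x) = s≤s (punchIn-above⇐ v x v≤x)

count-≥ : ∀ n m → ∑[ y < n ] 𝟙 (m ℕ.≤? toℕ y) ≡ n ∸ m
count-≥ zero    zero    = refl
count-≥ zero    (suc m) = refl
count-≥ (suc n) zero    = cong suc (trans
  (sum-cong-≗ {n} (λ y → 𝟙-cong (λ _ → z≤n) (λ _ → z≤n) (0 ℕ.≤? suc (toℕ y)) (0 ℕ.≤? toℕ y))) (count-≥ n zero))
count-≥ (suc n) (suc m) = trans
  (sum-cong-≗ {n} (λ y → 𝟙-cong ℕP.≤-pred s≤s _ (m ℕ.≤? toℕ y))) (count-≥ n m)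

count-< : ∀ n m → ∑[ j < n ] 𝟙 (toℕ j ℕ.<? m) ℕ.≤ m
count-< zero    m       = z≤n
count-< (suc n) zero    = ℕP.≤-trans
  (ℕP.≤-reflexive (sum-cong-≗ {n} (λ j → 𝟙-cong (λ ()) (λ ()) (suc (toℕ j) ℕ.<? 0) (toℕ j ℕ.<? 0)))) (count-< n zero)
count-< (suc n) (suc m) = s≤s (ℕP.≤-trans
  (ℕP.≤-reflexive (sum-cong-≗ {n} (λ j → 𝟙-cong ℕP.≤-pred s≤s _ (toℕ j ℕ.<? m)))) (count-< n m))

-- Θ π is an inversion sequence: at most i earlier positions exist.
Θ-isInvSeq : ∀ {n} (π : Permutation′ n) → IsInvSeq (Θ π)
Θ-isInvSeq {n} π i = subst (ℕ._≤ toℕ i) (sym (Θ≡invCount π i))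
  (ℕP.≤-trans (sum-mono {n} (counted (π ⟨$⟩ʳ_) i) (λ j → 𝟙 (toℕ j ℕ.<? toℕ i)) (λ j → 𝟙-mono proj₁ _ _)) (count-< n (toℕ i)))

module InsertedLast {n} (f : Fin (suc n) → Fin (suc n)) (σ : Permutation′ n) (v : Fin (suc n))
  (f-last : f (fromℕ n) ≡ v) (f-earlier : ∀ x → f (inject₁ x) ≡ punchIn v (σ ⟨$⟩ʳ x)) where

  -- Earlier counts are those of σ: the last position is never to the left.
  invCount-earlier : ∀ x → invCount f (inject₁ x) ≡ invCount (σ ⟨$⟩ʳ_) x
  invCount-earlier x = begin
    invCount f (inject₁ x)
      ≡⟨ sum-init-last {n} (counted f (inject₁ x)) ⟩
    ∑[ j < n ] counted f (inject₁ x) (inject₁ j) + counted f (inject₁ x) (fromℕ n)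
      ≡⟨ cong₂ _+_ (sum-cong-≗ λ j → 𝟙-cong (to j) (from j) _ _) (𝟙-no (fromℕ-maximal ∘ proj₁) _) ⟩
    invCount (σ ⟨$⟩ʳ_) x + 0
      ≡⟨ ℕP.+-identityʳ _ ⟩
    invCount (σ ⟨$⟩ʳ_) x ∎
    where
    open ≡-Reasoning
    to : ∀ j → inject₁ j F.< inject₁ x × f (inject₁ x) F.< f (inject₁ j) →
         j F.< x × σ ⟨$⟩ʳ x F.< σ ⟨$⟩ʳ j
    to j (j<x , fx<fj) = subst₂ ℕ._<_ (FP.toℕ-inject₁ j) (FP.toℕ-inject₁ x) j<x ,
      punchIn-cancel-< v (subst₂ F._<_ (f-earlier x) (f-earlier j) fx<fj)
    from : ∀ j → j F.< x × σ ⟨$⟩ʳ x F.< σ ⟨$⟩ʳ j →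
           inject₁ j F.< inject₁ x × f (inject₁ x) F.< f (inject₁ j)
    from j (j<x , σx<σj) = subst₂ ℕ._<_ (sym (FP.toℕ-inject₁ j)) (sym (FP.toℕ-inject₁ x)) j<x ,
      subst₂ F._<_ (sym (f-earlier x)) (sym (f-earlier j)) (punchIn-mono-< v σx<σj)

  -- The last count is the number of values above v, namely n ∸ v.
  invCount-last : invCount f (fromℕ n) ≡ n ∸ toℕ v
  invCount-last = begin
    invCount f (fromℕ n)
      ≡⟨ sum-init-last {n} (counted f (fromℕ n)) ⟩
    ∑[ j < n ] counted f (fromℕ n) (inject₁ j) + counted f (fromℕ n) (fromℕ n)
      ≡⟨ cong₂ _+_ (sum-cong-≗ λ j → 𝟙-cong (to j) (from j) _ _) (𝟙-no (FP.<-irrefl refl ∘ proj₁) _) ⟩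
    ∑[ j < n ] 𝟙 (toℕ v ℕ.≤? toℕ (σ ⟨$⟩ʳ j)) + 0
      ≡⟨ ℕP.+-identityʳ _ ⟩
    ∑[ j < n ] 𝟙 (toℕ v ℕ.≤? toℕ (σ ⟨$⟩ʳ j))
      ≡⟨ ∑-permute (λ y → 𝟙 (toℕ v ℕ.≤? toℕ y)) σ ⟨
    ∑[ y < n ] 𝟙 (toℕ v ℕ.≤? toℕ y)
      ≡⟨ count-≥ n (toℕ v) ⟩
    n ∸ toℕ v ∎
    where
    open ≡-Reasoning
    to : ∀ j → inject₁ j F.< fromℕ n × f (fromℕ n) F.< f (inject₁ j) → toℕ v ℕ.≤ toℕ (σ ⟨$⟩ʳ j)
    to j (_ , fn<fj) = punchIn-above⇒ v _ (subst₂ F._<_ f-last (f-earlier j) fn<fj)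
    from : ∀ j → toℕ v ℕ.≤ toℕ (σ ⟨$⟩ʳ j) → inject₁ j F.< fromℕ n × f (fromℕ n) F.< f (inject₁ j)
    from j v≤σj = subst₂ ℕ._<_ (sym (FP.toℕ-inject₁ j)) (sym (FP.toℕ-fromℕ n)) (FP.toℕ<n j) ,
      subst₂ F._<_ (sym f-last) (sym (f-earlier j)) (punchIn-above⇐ v _ v≤σj)

lastValue : ∀ n → ℕ → Fin (suc n)
lastValue n k = fromℕ< (s≤s (ℕP.m∸n≤m n k))

toℕ-lastValue : ∀ n k → toℕ (lastValue n k) ≡ n ∸ k
toℕ-lastValue n k = FP.toℕ-fromℕ< (s≤s (ℕP.m∸n≤m n k))

-- The inverse of Θ: decode the prefix, then insert the value n ∸ e_last at the end.
decode : ∀ n → (Fin n → ℕ) → Permutation′ n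
decode zero    e = P.id
decode (suc n) e = insert (fromℕ n) (lastValue n (e (fromℕ n))) (decode n (e ∘ inject₁))

decode-cong : ∀ n {e e′ : Fin n → ℕ} → (∀ i → e i ≡ e′ i) → decode n e P.≈ decode n e′
decode-cong zero    e≗e′ ()
decode-cong (suc n) e≗e′ i with lastView i
... | last = trans (insert-at (fromℕ n) _ _)
  (trans (cong (lastValue n) (e≗e′ (fromℕ n))) (sym (insert-at (fromℕ n) _ _)))
... | earlier x = trans (insert-last-earlier _ _ x)
  (trans (cong₂ punchIn (cong (lastValue n) (e≗e′ (fromℕ n))) (decode-cong n (e≗e′ ∘ inject₁) x))
    (sym (insert-last-earlier _ _ x)))

invCount-decode : ∀ n (e : Fin n → ℕ) → IsInvSeq e → ∀ i → invCount (decode n e ⟨$⟩ʳ_) i ≡ e i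
invCount-decode zero    e e-inv ()
invCount-decode (suc n) e e-inv i = counts i (lastView i)
  where
  open ≡-Reasoning
  open InsertedLast (decode (suc n) e ⟨$⟩ʳ_) (decode n (e ∘ inject₁)) (lastValue n (e (fromℕ n)))
    (insert-at (fromℕ n) _ _) (insert-last-earlier _ _)

  e-last≤n : e (fromℕ n) ℕ.≤ n
  e-last≤n = subst (e (fromℕ n) ℕ.≤_) (FP.toℕ-fromℕ n) (e-inv (fromℕ n))

  prefix-inv : IsInvSeq (e ∘ inject₁)
  prefix-inv y = subst (e (inject₁ y) ℕ.≤_) (FP.toℕ-inject₁ y) (e-inv (inject₁ y))

  counts : ∀ i → LastView i → invCount (decode (suc n) e ⟨$⟩ʳ_) i ≡ e i
  counts _ last = begin
    invCount (decode (suc n) e ⟨$⟩ʳ_) (fromℕ n)  ≡⟨ invCount-last ⟩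
    n ∸ toℕ (lastValue n (e (fromℕ n)))          ≡⟨ cong (n ∸_) (toℕ-lastValue n (e (fromℕ n))) ⟩
    n ∸ (n ∸ e (fromℕ n))                        ≡⟨ ℕP.m∸[m∸n]≡n e-last≤n ⟩
    e (fromℕ n)                                  ∎
  counts _ (earlier x) = trans (invCount-earlier x) (invCount-decode n (e ∘ inject₁) prefix-inv x)

decode-invCount : ∀ n (e : Fin n → ℕ) (π : Permutation′ n) → (∀ i → e i ≡ invCount (π ⟨$⟩ʳ_) i) →
  decode n e P.≈ π
decode-invCount zero    e π e≡ ()
decode-invCount (suc n) e π e≡ i = rebuild i (lastView i)
  where
  open ≡-Reasoning
  -- π is its prefix with the last value π (last) inserted at the end.
  prefix : Permutation′ n
  prefix = remove (fromℕ n) π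
  π-earlier : ∀ x → π ⟨$⟩ʳ inject₁ x ≡ punchIn (π ⟨$⟩ʳ fromℕ n) (prefix ⟨$⟩ʳ x)
  π-earlier x = trans (sym (P.insert-remove (fromℕ n) π (inject₁ x))) (insert-last-earlier _ prefix x)
  open InsertedLast (π ⟨$⟩ʳ_) prefix (π ⟨$⟩ʳ fromℕ n) refl π-earlier

  last-value : lastValue n (e (fromℕ n)) ≡ π ⟨$⟩ʳ fromℕ n
  last-value = FP.toℕ-injective (begin
    toℕ (lastValue n (e (fromℕ n)))  ≡⟨ toℕ-lastValue n (e (fromℕ n)) ⟩
    n ∸ e (fromℕ n)                  ≡⟨ cong (n ∸_) (trans (e≡ (fromℕ n)) invCount-last) ⟩
    n ∸ (n ∸ toℕ (π ⟨$⟩ʳ fromℕ n))   ≡⟨ ℕP.m∸[m∸n]≡n (FP.toℕ≤pred[n] (π ⟨$⟩ʳ fromℕ n)) ⟩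
    toℕ (π ⟨$⟩ʳ fromℕ n)             ∎)

  prefix-counts : ∀ y → e (inject₁ y) ≡ invCount (prefix ⟨$⟩ʳ_) y
  prefix-counts y = trans (e≡ (inject₁ y)) (invCount-earlier y)

  rebuild : ∀ i → LastView i → decode (suc n) e ⟨$⟩ʳ i ≡ π ⟨$⟩ʳ i
  rebuild _ last = trans (insert-at (fromℕ n) _ _) last-value
  rebuild _ (earlier x) = begin
    decode (suc n) e ⟨$⟩ʳ inject₁ x
      ≡⟨ insert-last-earlier _ _ x ⟩
    punchIn (lastValue n (e (fromℕ n))) (decode n (e ∘ inject₁) ⟨$⟩ʳ x)
      ≡⟨ cong₂ punchIn last-value (decode-invCount n (e ∘ inject₁) prefix prefix-counts x) ⟩
    punchIn (π ⟨$⟩ʳ fromℕ n) (prefix ⟨$⟩ʳ x)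
      ≡⟨ π-earlier x ⟨
    π ⟨$⟩ʳ inject₁ x ∎

Θ-inverse : ∀ {n} {R₁ R₂ : Rel ℕ 0ℓ} {C : Permutation′ n → Set} →
  (∀ π → (¬ C π) ⇔ (¬ ContainsRel R₁ R₂ (Θ π))) →
  Inverse (PermsAvoiding n (λ π → ¬ C π)) (InvSeqAvoiding n R₁ R₂)
Θ-inverse {n} {R₁} {R₂} avoid⇔ = record
  { to        = λ (π , ¬c) → Θ π , Θ-isInvSeq π , Equivalence.to (avoid⇔ π) ¬c
  ; from      = λ (e , e-inv , ¬rel) → decode n e ,
      Equivalence.from (avoid⇔ (decode n e)) (¬rel ∘ ContainsRel-cong {R₁ = R₁} {R₂} (Θ-decode e e-inv))
  ; to-cong   = λ {(π , _)} {(σ , _)} → Θ-cong {π = π} {σ}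
  ; from-cong = λ {(e , _)} {(e′ , _)} → decode-cong n {e} {e′}
  ; inverse   = (λ {(e , e-inv , _)} {(π , _)} π≈decode i →
                   trans (Θ-cong {π = π} {decode n e} π≈decode i) (Θ-decode e e-inv i))
              , (λ {(π , _)} {(e , _)} e≗Θπ →
                   decode-invCount n e π (λ i → trans (e≗Θπ i) (Θ≡invCount π i)))
  }
  where
  Θ-decode : ∀ e → IsInvSeq e → ∀ i → Θ (decode n e) i ≡ e i
  Θ-decode e e-inv i = trans (Θ≡invCount (decode n e) i) (invCount-decode n e e-inv i)

opposite-< : ∀ {n} {i j : Fin n} → i F.< j → opposite j F.< opposite i
opposite-< {n} {i} {j} i<j = subst₂ ℕ._<_ (sym (FP.opposite-prop j)) (sym (FP.opposite-prop i))
  (ℕP.∸-monoʳ-< (s≤s i<j) (FP.toℕ<n j))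

opposite-<⁻ : ∀ {n} {i j : Fin n} → opposite i F.< opposite j → j F.< i
opposite-<⁻ {i = i} {j} lt =
  subst₂ F._<_ (FP.opposite-involutive j) (FP.opposite-involutive i) (opposite-< lt)

opposite-⋖ : ∀ {n} {a b : Fin n} → a ⋖ b → opposite b ⋖ opposite a
opposite-⋖ {n} {a} {b} a⋖b = begin
  toℕ (opposite a)                 ≡⟨ FP.opposite-prop a ⟩
  n ∸ suc (toℕ a)                  ≡⟨ ℕP.+-∸-assoc 1 (subst (ℕ._< n) a⋖b (FP.toℕ<n b)) ⟩
  suc (n ∸ suc (suc (toℕ a)))      ≡⟨ cong (λ k → suc (n ∸ suc k)) a⋖b ⟨
  suc (n ∸ suc (toℕ b))            ≡⟨ cong suc (FP.opposite-prop b) ⟨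
  suc (toℕ (opposite b))           ∎
  where open ≡-Reasoning

involution-inverse : ∀ {n} {P Q : Permutation′ n → Set} (Φ : Permutation′ n → Permutation′ n) →
  (∀ {π σ} → π P.≈ σ → Φ π P.≈ Φ σ) → (∀ π → Φ (Φ π) P.≈ π) →
  (∀ π → Q (Φ π) → P π) → (∀ σ → P (Φ σ) → Q σ) →
  Inverse (PermsAvoiding n (λ π → ¬ P π)) (PermsAvoiding n (λ π → ¬ Q π))
involution-inverse Φ Φ-cong Φ-involutive Q⇒P P⇒Q = record
  { to        = λ (π , ¬p) → Φ π , ¬p ∘ Q⇒P π
  ; from      = λ (σ , ¬q) → Φ σ , ¬q ∘ P⇒Q σ
  ; to-cong   = Φ-cong
  ; from-cong = Φ-cong
  ; inverse   = (λ {(σ , _)} π≈Φσ i → trans (Φ-cong π≈Φσ i) (Φ-involutive σ i))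
              , (λ {(π , _)} σ≈Φπ i → trans (Φ-cong σ≈Φπ i) (Φ-involutive π i))
  }

-- Reverse-complement: i ↦ opposite (π (opposite i)).
reverseComplement : ∀ {n} → Permutation′ n → Permutation′ n
reverseComplement π = reverse ∘ₚ π ∘ₚ reverse

-- Reverse: i ↦ π (opposite i).
reversal : ∀ {n} → Permutation′ n → Permutation′ n
reversal π = reverse ∘ₚ π

2-134⇒124-3 : ∀ {n} (π : Permutation′ n) → Contains2-134 (reverseComplement π) → Contains124-3 π
2-134⇒124-3 π (j , i , i₁ , i₂ , (c₁ , c₂) , j<i , p₁ , p₂ , p₃) =
  opposite i₂ , opposite i₁ , opposite i , opposite j , (opposite-⋖ c₂ , opposite-⋖ c₁) ,
  opposite-< j<i , opposite-<⁻ p₃ , opposite-<⁻ p₂ , opposite-<⁻ p₁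

124-3⇒2-134 : ∀ {n} (π : Permutation′ n) → Contains124-3 (reverseComplement π) → Contains2-134 π
124-3⇒2-134 π (i , i₁ , i₂ , k , (c₁ , c₂) , i₂<k , p₁ , p₂ , p₃) =
  opposite k , opposite i₂ , opposite i₁ , opposite i , (opposite-⋖ c₂ , opposite-⋖ c₁) ,
  opposite-< i₂<k , opposite-<⁻ p₃ , opposite-<⁻ p₂ , opposite-<⁻ p₁

3-124⇒421-3 : ∀ {n} (π : Permutation′ n) → Contains3-124 (reversal π) → Contains421-3 π
3-124⇒421-3 π (j , i , i₁ , i₂ , (c₁ , c₂) , j<i , p₁ , p₂ , p₃) =
  opposite i₂ , opposite i₁ , opposite i , opposite j , (opposite-⋖ c₂ , opposite-⋖ c₁) ,
  opposite-< j<i , p₁ , p₂ , p₃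

421-3⇒3-124 : ∀ {n} (π : Permutation′ n) → Contains421-3 (reversal π) → Contains3-124 π
421-3⇒3-124 π (i , i₁ , i₂ , k , (c₁ , c₂) , i₂<k , p₁ , p₂ , p₃) =
  opposite k , opposite i₂ , opposite i₁ , opposite i , (opposite-⋖ c₂ , opposite-⋖ c₁) ,
  opposite-< i₂<k , p₁ , p₂ , p₃

reverseComplement-inverse : ∀ n →
  Inverse (PermsAvoiding n (λ π → ¬ Contains124-3 π)) (PermsAvoiding n (λ π → ¬ Contains2-134 π))
reverseComplement-inverse n = involution-inverse reverseComplement
  (λ π≈σ i → cong opposite (π≈σ (opposite i)))
  (λ π i → trans (FP.opposite-involutive _) (cong (π ⟨$⟩ʳ_) (FP.opposite-involutive i)))
  2-134⇒124-3 124-3⇒2-134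

reversal-inverse : ∀ n →
  Inverse (PermsAvoiding n (λ π → ¬ Contains421-3 π)) (PermsAvoiding n (λ π → ¬ Contains3-124 π))
reversal-inverse n = involution-inverse reversal
  (λ π≈σ i → π≈σ (opposite i))
  (λ π i → cong (π ⟨$⟩ʳ_) (FP.opposite-involutive i))
  3-124⇒421-3 421-3⇒3-124

proposition3p8 : (n : ℕ) →
    (((π : Permutation′ n) → (¬ Contains2-134 π) ⇔ (¬ ContainsRel _>_ _≥_ (Θ π)))
      × Inverse (PermsAvoiding n (λ π → ¬ Contains124-3 π)) (PermsAvoiding n (λ π → ¬ Contains2-134 π))
      × Inverse (PermsAvoiding n (λ π → ¬ Contains2-134 π)) (InvSeqAvoiding n _>_ _≥_))
    × (((π : Permutation′ n) → (¬ Contains3-124 π) ⇔ (¬ ContainsRel _≥_ _>_ (Θ π)))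
      × Inverse (PermsAvoiding n (λ π → ¬ Contains421-3 π)) (PermsAvoiding n (λ π → ¬ Contains3-124 π))
      × Inverse (PermsAvoiding n (λ π → ¬ Contains3-124 π)) (InvSeqAvoiding n _≥_ _>_))
proposition3p8 n =
  (avoid2-134⇔ , reverseComplement-inverse n , Θ-inverse {R₁ = _>_} {_≥_} avoid2-134⇔) ,
  (avoid3-124⇔ , reversal-inverse n , Θ-inverse {R₁ = _≥_} {_>_} avoid3-124⇔)
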